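{- Let $n\ge4$ and let $k,z$ be integers with $3\le k$ and $0\le z<k\le n$, and $k\le m_{k+1}\le\cdots\le m_n$. Let $\Omega=(V_1,\ldots,V_n,E)$ be an octahedral system without isolated vertex with $|V_i|=k-1$ for $1\le i\le z$, $|V_i|=k$ for $z<i\le k$, and $|V_i|=m_i$ for $k<i\le n$. Suppose there is a subset $X\subseteq\bigcup_{i=z+1}^nV_i$ with $|X|\ge2$ that induces a complete subgraph in $D(\Omega)$ and has no outneighbour in $D(\Omega)$. Then $\Omega$ has at least $(k-1)^2+2$ edges, unless $\Omega$ is a $(2,2,3,3)$-octahedral system (i.e. $n=4$ and $(|V_1|,|V_2|,|V_3|,|V_4|)=(2,2,3,3)$); in that exceptional case $\Omega$ has at least $5$ edges.
   Context: An $n$-uniform hypergraph is $n$-partite if its vertex set is the disjoint union of $n$ sets $V_1,\ldots,V_n$ and each edge meets each $V_i$ in exactly one vertex; it is written $(V_1,\ldots,V_n,E)$. An octahedral system is such a hypergraph with $|V_i|\ge 2$ for all $i$ satisfying the parity condition: for every $X\subseteq\bigcup_i V_i$ with $|X\cap V_i|=2$ for all $i$, the number of edges contained in $X$ is even. A vertex is isolated if it belongs to no edge. $D(\Omega)$ is the directed graph on $V=\bigcup_iV_i$ with an arc $(u,v)$ ($u\neq v$) whenever every edge containing $v$ also contains $u$. $X$ induces a complete subgraph if $(u,v)$ is an arc for all distinct $u,v\in X$; $X$ has no outneighbour if no arc $(u,w)$ with $u\in X$ has $w\notin X$. -}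

module Defs where

open import Data.Nat using (ℕ; _<_; _≤_; _≡ᵇ_; _∸_; _^_; _+_)
open import Data.Nat.Divisibility using (_∣_)
open import Data.Bool using (Bool; true; _∧_; _∨_)
open import Data.Fin using (Fin; toℕ)
open import Data.Vec using (Vec; []; _∷_; lookup)
open import Data.List using (List; length; filterᵇ)
open import Data.List.Membership.Propositional using (_∈_)
open import Data.List.Relation.Unary.All using (All)
open import Data.List.Relation.Unary.Unique.Propositional using (Unique)
open import Data.Product using (_×_; Σ; ∃)
open import Relation.Binary.PropositionalEquality using (_≡_; _≢_)

-- An n-partite n-uniform hypergraph (V_1,...,V_n,E):
--   part i (i : Fin n, 0-based) is V_i = {0, ..., s i - 1}  (so |V_i| = s i);
--   a vertex is a pair (i , j) with j < s i;
--   an edge is a vector e : Vec ℕ n with lookup e i < s i (e meets V_i exactly in (i , lookup e i));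
--   E is a duplicate-free list of edges.

Edge : ℕ → Set
Edge n = Vec ℕ n

Vertex : ℕ → Set
Vertex n = Fin n × ℕ

ValidVertex : ∀ {n} → (Fin n → ℕ) → Vertex n → Set
ValidVertex s (i Data.Product., j) = j < s i

ValidEdge : ∀ {n} → (Fin n → ℕ) → Edge n → Set
ValidEdge s e = ∀ i → lookup e i < s i

record Hypergraph (n : ℕ) (s : Fin n → ℕ) : Set where
  field
    edges    : List (Edge n)
    unique   : Unique edges
    valid    : All (ValidEdge s) edges

open Hypergraph public

_∈ᵉ_ : ∀ {n} → Vertex n → Edge n → Set
(i Data.Product., j) ∈ᵉ e = lookup e i ≡ j

inBox : ∀ {n} → Vec ℕ n → Vec ℕ n → Vec ℕ n → Bool
inBox [] [] [] = true
inBox (x ∷ xs) (a ∷ as) (b ∷ bs) = ((x ≡ᵇ a) ∨ (x ≡ᵇ b)) ∧ inBox xs as bs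

-- number of edges contained in X = ⋃_i {(i , a_i) , (i , b_i)}
edgesIn : ∀ {n} → List (Edge n) → Vec ℕ n → Vec ℕ n → ℕ
edgesIn E a b = length (filterᵇ (λ e → inBox e a b) E)

IsOctahedral : ∀ {n} {s : Fin n → ℕ} → Hypergraph n s → Set
IsOctahedral {n} {s} H =
  (∀ i → 2 ≤ s i) ×
  (∀ (a b : Vec ℕ n) →
     (∀ i → lookup a i < s i) → (∀ i → lookup b i < s i) → (∀ i → lookup a i ≢ lookup b i) →
     2 ∣ edgesIn (edges H) a b)

NoIsolated : ∀ {n} {s : Fin n → ℕ} → Hypergraph n s → Set
NoIsolated {n} {s} H = ∀ (v : Vertex n) → ValidVertex s v → ∃ λ e → e ∈ edges H × v ∈ᵉ e

Arc : ∀ {n} {s : Fin n → ℕ} → Hypergraph n s → Vertex n → Vertex n → Set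
Arc H u v = u ≢ v × (∀ e → e ∈ edges H → v ∈ᵉ e → u ∈ᵉ e)

InducesComplete : ∀ {n} {s : Fin n → ℕ} → Hypergraph n s → List (Vertex n) → Set
InducesComplete H X = ∀ u v → u ∈ X → v ∈ X → u ≢ v → Arc H u v

NoOutneighbour : ∀ {n} {s : Fin n → ℕ} → Hypergraph n s → List (Vertex n) → Set
NoOutneighbour {n} {s} H X = ∀ u w → u ∈ X → ValidVertex s w → Arc H u w → w ∈ X

module Submission where

-- Only two vertices of X are used: (p , xp) and (q , xq) are twins (an edge contains one
-- iff it contains the other) and lie in distinct parts.  The argument counts edges.
--  * Subcube lemma: if the boxes of a subcube (some coordinates free, the others fixed)
--    satisfy the parity condition and the subcube contains an edge, it contains at least
--    as many edges as its smallest free part; induction on the free coordinates, using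
--    that an empty slice lets parity descend to a nonempty slice.
--  * Twin parity: for u ≢ xp, w ≢ xq, the edges of a box with corners (xp , xq) and
--    (u , w) in parts p, q are the twin edges plus those of the cell (u , w).  With the
--    subcube lemma this gives deg u ≥ m for every vertex (p , u) ≠ (p , xp), whence
--    |E| ≥ deg xp + (|V_p| - 1) m; when deg xp = 1 two sharper bounds follow.
--  * Arithmetic with m = k - 1 gives |E| ≥ (k - 1)² + 2, except in a configuration that
--    the size profile forces to be (2,2,3,3); there |E| ≥ 5 still holds.


open import Defs
open import Algebra.Properties.CommutativeSemigroup using (interchange)
open import Data.Bool using (T)
open import Data.Bool.Properties using (T-∧; T-∨)
open import Data.Empty using (⊥; ⊥-elim)
open import Data.Fin using (Fin; zero; suc; toℕ) renaming (_≟_ to _≟ᶠ_)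
open import Data.Fin.Patterns using (0F; 1F; 2F; 3F; 4F)
open import Data.Fin.Properties using (all?; any?)
open import Data.List using (List; []; _∷_; length; filter; allFin; tabulate)
open import Data.List.Membership.Propositional using (_∈_; _∉_)
open import Data.List.Membership.Propositional.Properties using (∈-filter⁺; ∈-filter⁻; ∈-allFin)
open import Data.List.Relation.Unary.All as All using (All; _∷_)
open import Data.List.Relation.Unary.AllPairs using (_∷_)
open import Data.List.Relation.Unary.Any as Any using (here; there)
open import Data.List.Relation.Unary.Unique.Propositional using (Unique)
open import Data.List.Relation.Unary.Unique.Propositional.Properties using (filter⁺; allFin⁺)
open import Data.Nat using (ℕ; zero; suc; _<_; _≤_; _∸_; _^_; _+_; _*_; z≤n; s≤s; _≟_; _≤?_; _<?_; _≡ᵇ_)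
open import Data.Nat.Divisibility using (_∣_; ∣m+n∣m⇒∣n; ∣1⇒≡1)
open import Data.Nat.Properties
open import Data.Product using (_×_; _,_; proj₁; proj₂; ∃)
open import Data.Sum using (_⊎_; inj₁; inj₂; [_,_]; [_,_]′; map₂)
open import Data.Unit using (tt)
open import Data.Vec as Vec using (Vec; lookup; _[_]≔_)
open import Data.Vec.Properties using (≡-dec; lookup∘update; lookup∘update′; lookup-map; tabulate∘lookup; tabulate-cong)
open import Function using (_∘_; id; Equivalence)
open import Relation.Binary.PropositionalEquality using (_≡_; _≢_; ≢-sym; refl; sym; trans; cong; cong₂; subst; module ≡-Reasoning)
open import Relation.Nullary using (¬_; Dec; yes; no)
open import Relation.Nullary.Decidable using (_×-dec_; _⊎-dec_; _→-dec_; ¬?; T?)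
open import Relation.Unary using (Decidable)

+-interchange : ∀ a b c d → (a + b) + (c + d) ≡ (a + c) + (b + d)
+-interchange = interchange +-commutativeSemigroup

+-rearrange : ∀ a b c → a + (b + c) ≡ (a + c) + b
+-rearrange a b c = trans (cong (a +_) (+-comm b c)) (sym (+-assoc a c b))

indicator : {P : Set} → Dec P → ℕ
indicator (yes _) = 1
indicator (no _)  = 0

count : {A : Set} {P : A → Set} → Decidable P → List A → ℕ
count P? []       = 0
count P? (x ∷ xs) = indicator (P? x) + count P? xs

module _ {A : Set} where

  _⇒[_]_ : (A → Set) → List A → (A → Set) → Set
  P ⇒[ L ] Q = ∀ x → x ∈ L → P x → Q x

  tail⇒ : {P Q : A → Set} {x : A} {L : List A} → P ⇒[ x ∷ L ] Q → P ⇒[ L ] Q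
  tail⇒ h y y∈L = h y (there y∈L)

  count-filter : {P : A → Set} (P? : Decidable P) (L : List A) → length (filter P? L) ≡ count P? L
  count-filter P? [] = refl
  count-filter P? (x ∷ L) with P? x
  ... | yes _ = cong suc (count-filter P? L)
  ... | no _  = count-filter P? L

  count-mono : {P Q : A → Set} (P? : Decidable P) (Q? : Decidable Q) (L : List A) →
    P ⇒[ L ] Q → count P? L ≤ count Q? L
  count-mono P? Q? [] h = z≤n
  count-mono {P} {Q} P? Q? (x ∷ L) h = +-mono-≤ (head (P? x) (Q? x)) (count-mono P? Q? L (tail⇒ h))
    where
    head : (p : Dec (P x)) (q : Dec (Q x)) → indicator p ≤ indicator q
    head (yes p) (yes _) = ≤-refl
    head (yes p) (no ¬q) = ⊥-elim (¬q (h x (here refl) p))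
    head (no _)  _       = z≤n

  count-ext : {P Q : A → Set} (P? : Decidable P) (Q? : Decidable Q) (L : List A) →
    P ⇒[ L ] Q → Q ⇒[ L ] P → count P? L ≡ count Q? L
  count-ext P? Q? L P⇒Q Q⇒P = ≤-antisym (count-mono P? Q? L P⇒Q) (count-mono Q? P? L Q⇒P)

  count-split : {P Q R : A → Set} (P? : Decidable P) (Q? : Decidable Q) (R? : Decidable R) (L : List A) →
    P ⇒[ L ] (λ x → Q x ⊎ R x) → Q ⇒[ L ] P → R ⇒[ L ] P → Q ⇒[ L ] (λ x → ¬ R x) →
    count P? L ≡ count Q? L + count R? L
  count-split P? Q? R? [] _ _ _ _ = refl
  count-split {P} {Q} {R} P? Q? R? (x ∷ L) h₁ h₂ h₃ h₄ = begin
      indicator (P? x) + count P? L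
    ≡⟨ cong₂ _+_ (head (P? x) (Q? x) (R? x)) (count-split P? Q? R? L (tail⇒ h₁) (tail⇒ h₂) (tail⇒ h₃) (tail⇒ h₄)) ⟩
      (indicator (Q? x) + indicator (R? x)) + (count Q? L + count R? L)
    ≡⟨ +-interchange (indicator (Q? x)) (indicator (R? x)) (count Q? L) (count R? L) ⟩
      (indicator (Q? x) + count Q? L) + (indicator (R? x) + count R? L)
    ∎
    where
    open ≡-Reasoning
    head : (p : Dec (P x)) (q : Dec (Q x)) (r : Dec (R x)) → indicator p ≡ indicator q + indicator r
    head _       (yes q) (yes r) = ⊥-elim (h₄ x (here refl) q r)
    head (yes _) (yes _) (no _)  = refl
    head (yes _) (no _)  (yes _) = refl
    head (yes p) (no ¬q) (no ¬r) = ⊥-elim ([ ¬q , ¬r ] (h₁ x (here refl) p))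
    head (no ¬p) (yes q) _       = ⊥-elim (¬p (h₂ x (here refl) q))
    head (no ¬p) (no _)  (yes r) = ⊥-elim (¬p (h₃ x (here refl) r))
    head (no _)  (no _)  (no _)  = refl

  count-pos : {P : A → Set} (P? : Decidable P) {L : List A} {x : A} → x ∈ L → P x → 1 ≤ count P? L
  count-pos P? {y ∷ L} (here refl) py with P? y
  ... | yes _ = s≤s z≤n
  ... | no ¬p = ⊥-elim (¬p py)
  count-pos P? {y ∷ L} (there x∈L) px = ≤-trans (count-pos P? x∈L px) (m≤n+m _ _)

  count-two : {P : A → Set} (P? : Decidable P) {L : List A} {x y : A} →
    x ∈ L → y ∈ L → x ≢ y → P x → P y → 2 ≤ count P? L
  count-two P? (here refl) (here refl) x≢y _ _ = ⊥-elim (x≢y refl)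
  count-two P? {x ∷ L} (here refl) (there y∈L) _ px py with P? x
  ... | yes _ = s≤s (count-pos P? y∈L py)
  ... | no ¬p = ⊥-elim (¬p px)
  count-two P? {y ∷ L} (there x∈L) (here refl) _ px py with P? y
  ... | yes _ = s≤s (count-pos P? x∈L px)
  ... | no ¬p = ⊥-elim (¬p py)
  count-two P? (there x∈L) (there y∈L) x≢y px py = ≤-trans (count-two P? x∈L y∈L x≢y px py) (m≤n+m _ _)

  count-none : {P : A → Set} (P? : Decidable P) (L : List A) → (∀ x → x ∈ L → ¬ P x) → count P? L ≡ 0
  count-none P? [] h = refl
  count-none P? (x ∷ L) h with P? x
  ... | yes px = ⊥-elim (h x (here refl) px)
  ... | no _   = count-none P? L (tail⇒ h)

  count-≤1 : {P : A → Set} (P? : Decidable P) (L : List A) → Unique L →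
    (∀ x y → x ∈ L → y ∈ L → P x → P y → x ≡ y) → count P? L ≤ 1
  count-≤1 P? [] _ _ = z≤n
  count-≤1 P? (x ∷ L) (x∉L ∷ unique) h with P? x
  ... | yes px = ≤-reflexive (cong suc (count-none P? L
                   (λ y y∈L py → All.lookup x∉L y∈L (h x y (here refl) (there y∈L) px py))))
  ... | no _   = count-≤1 P? L unique (λ y z y∈L z∈L → h y z (there y∈L) (there z∈L))

  count-all : (L : List A) → count (λ _ → yes tt) L ≡ length L
  count-all []      = refl
  count-all (_ ∷ L) = cong suc (count-all L)

sumTo : ℕ → (ℕ → ℕ) → ℕ
sumTo zero    f = 0
sumTo (suc N) f = sumTo N f + f N

sumTo-+ : ∀ N (f g : ℕ → ℕ) → sumTo N (λ v → f v + g v) ≡ sumTo N f + sumTo N g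
sumTo-+ zero    f g = refl
sumTo-+ (suc N) f g = trans (cong (_+ (f N + g N)) (sumTo-+ N f g)) (+-interchange (sumTo N f) (sumTo N g) (f N) (g N))

sumTo-zero : ∀ N → sumTo N (λ _ → 0) ≡ 0
sumTo-zero zero    = refl
sumTo-zero (suc N) = trans (+-identityʳ _) (sumTo-zero N)

restrict : ∀ {N} {P : ℕ → Set} → (∀ v → v < suc N → P v) → ∀ v → v < N → P v
restrict h v v<N = h v (m≤n⇒m≤1+n v<N)

sum-indicator-≤1 : {Q : ℕ → Set} (Q? : Decidable Q) (g : ℕ) → (∀ v → Q v → v ≡ g) →
  ∀ N → sumTo N (indicator ∘ Q?) ≤ 1
sum-indicator-≤1 Q? g solution N = proj₁ (bounds N)
  where
  bounds : ∀ N → sumTo N (indicator ∘ Q?) ≤ 1 × (N ≤ g → sumTo N (indicator ∘ Q?) ≡ 0)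
  bounds zero = z≤n , λ _ → refl
  bounds (suc N) with Q? N | bounds N
  ... | yes q | (_ , vanish) rewrite vanish (≤-reflexive (solution N q)) =
    ≤-refl , λ N<g → ⊥-elim (<-irrefl (solution N q) N<g)
  ... | no _  | (≤1 , vanish) rewrite +-identityʳ (sumTo N (indicator ∘ Q?)) =
    ≤1 , λ N<g → vanish (<⇒≤ N<g)

sum-indicator-none : {Q : ℕ → Set} (Q? : Decidable Q) → (∀ v → ¬ Q v) → ∀ N → sumTo N (indicator ∘ Q?) ≡ 0
sum-indicator-none Q? none zero = refl
sum-indicator-none Q? none (suc N) with Q? N
... | yes q = ⊥-elim (none N q)
... | no _  = trans (+-identityʳ _) (sum-indicator-none Q? none N)

count-fibres : {A : Set} {P : A → Set} {Q : ℕ → A → Set} (P? : Decidable P) (Q? : ∀ v → Decidable (Q v))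
  (g : A → ℕ) (N : ℕ) (L : List A) → (∀ v x → x ∈ L → Q v x → P x × g x ≡ v) →
  sumTo N (λ v → count (Q? v) L) ≤ count P? L
count-fibres P? Q? g N [] h = ≤-reflexive (sumTo-zero N)
count-fibres P? Q? g N (x ∷ L) h =
  subst (_≤ indicator (P? x) + count P? L) (sym (sumTo-+ N (λ v → indicator (Q? v x)) (λ v → count (Q? v) L)))
    (+-mono-≤ (head (P? x)) (count-fibres P? Q? g N L (λ v y y∈L → h v y (there y∈L))))
  where
  head : (p : Dec _) → sumTo N (λ v → indicator (Q? v x)) ≤ indicator p
  head (yes _) = sum-indicator-≤1 (λ v → Q? v x) (g x) (λ v q → sym (proj₂ (h v x (here refl) q))) N
  head (no ¬p) = ≤-reflexive (sum-indicator-none (λ v → Q? v x) (λ v q → ¬p (proj₁ (h v x (here refl) q))) N)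

sum-≥ : ∀ N (f : ℕ → ℕ) b → (∀ v → v < N → b ≤ f v) → N * b ≤ sumTo N f
sum-≥ zero    f b h = z≤n
sum-≥ (suc N) f b h =
  subst (_≤ sumTo N f + f N) (+-comm (N * b) b) (+-mono-≤ (sum-≥ N f b (restrict h)) (h N ≤-refl))

sum-> : ∀ N (f : ℕ → ℕ) b y → y < N → (∀ v → v < N → b ≤ f v) → b < f y → suc (N * b) ≤ sumTo N f
sum-> (suc N) f b y y<N h b<fy with m<1+n⇒m<n∨m≡n y<N
... | inj₁ y<N′ = subst (_≤ sumTo N f + f N) (cong suc (+-comm (N * b) b))
                    (+-mono-≤ (sum-> N f b y y<N′ (restrict h) b<fy) (h N ≤-refl))
... | inj₂ refl = subst (_≤ sumTo N f + f N) (trans (+-suc (N * b) b) (cong suc (+-comm (N * b) b)))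
                    (+-mono-≤ (sum-≥ N f b (restrict h)) b<fy)

sum-≥-but : ∀ N (f : ℕ → ℕ) b x → x < N → (∀ v → v < N → v ≢ x → b ≤ f v) → f x + (N ∸ 1) * b ≤ sumTo N f
sum-≥-but (suc N) f b x x<N h with m<1+n⇒m<n∨m≡n x<N
... | inj₂ refl = subst (_≤ sumTo N f + f N) (+-comm (N * b) (f N))
                    (+-mono-≤ (sum-≥ N f b (λ v v<N → h v (m≤n⇒m≤1+n v<N) (<⇒≢ v<N))) ≤-refl)
sum-≥-but (suc (suc N)) f b x x<N h | inj₁ x<N′ =
  subst (_≤ sumTo (suc N) f + f (suc N)) (sym (+-rearrange (f x) b (N * b)))
    (+-mono-≤ (sum-≥-but (suc N) f b x x<N′ (restrict h)) (h (suc N) ≤-refl (≢-sym (<⇒≢ x<N′))))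

sum->-but : ∀ N (f : ℕ → ℕ) b x y → x < N → y < N → x ≢ y → (∀ v → v < N → v ≢ x → b ≤ f v) → b < f y →
  suc (f x + (N ∸ 1) * b) ≤ sumTo N f
sum->-but (suc N) f b x y x<N y<N x≢y h b<fy with m<1+n⇒m<n∨m≡n x<N | m<1+n⇒m<n∨m≡n y<N
... | inj₂ refl | inj₂ refl = ⊥-elim (x≢y refl)
... | inj₂ refl | inj₁ y<N′ = subst (_≤ sumTo N f + f N) (cong suc (+-comm (N * b) (f N)))
  (+-mono-≤ (sum-> N f b y y<N′ (λ v v<N → h v (m≤n⇒m≤1+n v<N) (<⇒≢ v<N)) b<fy) (≤-refl {f N}))
sum->-but (suc (suc N)) f b x y x<N y<N x≢y h b<fy | inj₁ x<N′ | inj₂ refl =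
  subst (_≤ sumTo (suc N) f + f (suc N)) (trans (+-suc _ b) (cong suc (sym (+-rearrange (f x) b (N * b)))))
    (+-mono-≤ (sum-≥-but (suc N) f b x x<N′ (restrict h)) b<fy)
sum->-but (suc (suc N)) f b x y x<N y<N x≢y h b<fy | inj₁ x<N′ | inj₁ y<N′ =
  subst (_≤ sumTo (suc N) f + f (suc N)) (cong suc (sym (+-rearrange (f x) b (N * b))))
    (+-mono-≤ (sum->-but (suc N) f b x y x<N′ y<N′ x≢y (restrict h) b<fy) (h (suc N) ≤-refl (≢-sym (<⇒≢ x<N′))))

vec-ext : ∀ {n} (u v : Vec ℕ n) → (∀ i → lookup u i ≡ lookup v i) → u ≡ v
vec-ext u v h = trans (sym (tabulate∘lookup u)) (trans (tabulate-cong h) (tabulate∘lookup v))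

InBox : ∀ {n} → Vec ℕ n → Vec ℕ n → Vec ℕ n → Set
InBox a b f = ∀ i → lookup f i ≡ lookup a i ⊎ lookup f i ≡ lookup b i

InBox? : ∀ {n} (a b : Vec ℕ n) → Decidable (InBox a b)
InBox? a b f = all? (λ i → (lookup f i ≟ lookup a i) ⊎-dec (lookup f i ≟ lookup b i))

inBox-sound : ∀ {n} (f a b : Vec ℕ n) → T (inBox f a b) → InBox a b f
inBox-sound (x Vec.∷ f) (a₀ Vec.∷ a) (b₀ Vec.∷ b) t with Equivalence.to T-∧ t
... | t₀ , t′ = λ { zero → head (Equivalence.to T-∨ t₀) ; (suc i) → inBox-sound f a b t′ i }
  where
  head : T (x ≡ᵇ a₀) ⊎ T (x ≡ᵇ b₀) → x ≡ a₀ ⊎ x ≡ b₀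
  head = Data.Sum.map (≡ᵇ⇒≡ x a₀) (≡ᵇ⇒≡ x b₀)

inBox-complete : ∀ {n} (f a b : Vec ℕ n) → InBox a b f → T (inBox f a b)
inBox-complete Vec.[] Vec.[] Vec.[] _ = tt
inBox-complete (x Vec.∷ f) (a₀ Vec.∷ a) (b₀ Vec.∷ b) h =
  Equivalence.from T-∧ (Equivalence.from T-∨ (Data.Sum.map (≡⇒≡ᵇ x a₀) (≡⇒≡ᵇ x b₀) (h zero)) ,
                        inBox-complete f a b (h ∘ suc))

edgesIn≡count : ∀ {n} (E : List (Vec ℕ n)) a b → edgesIn E a b ≡ count (InBox? a b) E
edgesIn≡count E a b = trans (count-filter (λ f → T? (inBox f a b)) E)
  (count-ext _ _ E (λ f _ → inBox-sound f a b) (λ f _ → inBox-complete f a b))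

box-widen : ∀ {n} (a b : Vec ℕ n) i v (L : List (Vec ℕ n)) → lookup a i ≡ lookup b i →
  count (InBox? a (b [ i ]≔ v)) L ≡
  count (InBox? a b) L + count (λ f → InBox? a (b [ i ]≔ v) f ×-dec ¬? (lookup f i ≟ lookup a i)) L
box-widen a b i v L aᵢ≡bᵢ = count-split _ _ _ L split narrow (λ _ _ → proj₁) disjoint
  where
  at-a : ∀ f → InBox a b f → lookup f i ≡ lookup a i
  at-a f f∈ = [ id , (λ e → trans e (sym aᵢ≡bᵢ)) ] (f∈ i)
  split : ∀ f → f ∈ L → InBox a (b [ i ]≔ v) f → InBox a b f ⊎ (InBox a (b [ i ]≔ v) f × lookup f i ≢ lookup a i)
  split f _ f∈ with lookup f i ≟ lookup a i
  ... | no fᵢ≢aᵢ = inj₂ (f∈ , fᵢ≢aᵢ)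
  ... | yes fᵢ≡aᵢ = inj₁ narrowed
    where
    narrowed : InBox a b f
    narrowed j with j ≟ᶠ i
    ... | yes refl = inj₁ fᵢ≡aᵢ
    ... | no j≢i   = map₂ (λ e → trans e (lookup∘update′ j≢i b v)) (f∈ j)
  narrow : ∀ f → f ∈ L → InBox a b f → InBox a (b [ i ]≔ v) f
  narrow f _ f∈ j with j ≟ᶠ i
  ... | yes refl = inj₁ (at-a f f∈)
  ... | no j≢i   = map₂ (λ e → trans e (sym (lookup∘update′ j≢i b v))) (f∈ j)
  disjoint : ∀ f → f ∈ L → InBox a b f → ¬ (InBox a (b [ i ]≔ v) f × lookup f i ≢ lookup a i)
  disjoint f _ f∈ (_ , fᵢ≢aᵢ) = fᵢ≢aᵢ (at-a f f∈)

edge-valid : ∀ {n} {s : Fin n → ℕ} (H : Hypergraph n s) → ∀ e → e ∈ edges H → ∀ i → lookup e i < s i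
edge-valid H e e∈E = All.lookup (valid H) e∈E

box-parity : ∀ {n} {s : Fin n → ℕ} (H : Hypergraph n s) → IsOctahedral H →
  ∀ a b → (∀ i → lookup a i < s i) → (∀ i → lookup b i < s i) → (∀ i → lookup a i ≢ lookup b i) →
  2 ∣ count (InBox? a b) (edges H)
box-parity H oct a b a-valid b-valid differ =
  subst (2 ∣_) (edgesIn≡count (edges H) a b) (proj₂ oct a b a-valid b-valid differ)

-- An arc of D(Ω) never joins two vertices of the same part, as an edge through the
-- head would then meet that part twice.
arc-parts-differ : ∀ {n} {s : Fin n → ℕ} (H : Hypergraph n s) → NoIsolated H →
  ∀ {p q xp xq} → xp < s p → Arc H (q , xq) (p , xp) → p ≢ q
arc-parts-differ H noiso xp<sp (distinct , covers) refl with noiso (_ , _) xp<sp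
... | e , e∈E , eₚ≡xp = distinct (cong (_ ,_) (trans (sym (covers e e∈E eₚ≡xp)) eₚ≡xp))

2∤1 : ¬ (2 ∣ 1)
2∤1 2∣1 with ∣1⇒≡1 2∣1
... | ()

module Subcube {n : ℕ} (s : Fin n → ℕ) (E : List (Vec ℕ n)) (E-unique : Unique E)
  (E-valid : ∀ e → e ∈ E → ∀ i → lookup e i < s i) where

  Agree : List (Fin n) → Vec ℕ n → Vec ℕ n → Set
  Agree Is c f = ∀ j → j ∉ Is → lookup f j ≡ lookup c j

  Agree? : ∀ Is c → Decidable (Agree Is c)
  Agree? Is c f = all? (λ j → ¬? (Any.any? (j ≟ᶠ_) Is) →-dec (lookup f j ≟ lookup c j))

  Parity : List (Fin n) → Vec ℕ n → Set
  Parity Is c = ∀ a b →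
    (∀ i → i ∈ Is → lookup a i < s i × lookup b i < s i × lookup a i ≢ lookup b i) →
    (∀ i → i ∉ Is → lookup a i ≡ lookup c i × lookup b i ≡ lookup c i) →
    2 ∣ count (InBox? a b) E

  -- Without free coordinates the only box is the point c itself: it contains at most one
  -- edge, so the parity condition forbids an edge there.
  point-parity : ∀ c {e} → Parity [] c → e ∈ E → Agree [] c e → ⊥
  point-parity c {e} parity e∈E e≈c = 2∤1 (subst (2 ∣_) one-edge (parity c c (λ _ ()) (λ _ _ → refl , refl)))
    where
    only-c : ∀ f → InBox c c f → f ≡ c
    only-c f f∈ = vec-ext f c (λ j → [ id , id ] (f∈ j))
    one-edge : count (InBox? c c) E ≡ 1
    one-edge = ≤-antisym
      (count-≤1 (InBox? c c) E E-unique (λ f g _ _ f∈ g∈ → trans (only-c f f∈) (sym (only-c g g∈))))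
      (count-pos (InBox? c c) e∈E (λ j → inj₁ (e≈c j (λ ()))))

  module Fibres {i : Fin n} {Is : List (Fin n)} (i∉Is : i ∉ Is) (c : Vec ℕ n) where

    fibre : ℕ → ℕ
    fibre v = count (Agree? Is (c [ i ]≔ v)) E

    fibre⇒ : ∀ {v} f → Agree Is (c [ i ]≔ v) f → Agree (i ∷ Is) c f × lookup f i ≡ v
    fibre⇒ {v} f f≈ = outside , trans (f≈ i i∉Is) (lookup∘update i c v)
      where
      outside : Agree (i ∷ Is) c f
      outside j j∉ = trans (f≈ j (j∉ ∘ there)) (lookup∘update′ (λ { refl → j∉ (here refl) }) c v)

    ⇒fibre : ∀ {v} f → Agree (i ∷ Is) c f → lookup f i ≡ v → Agree Is (c [ i ]≔ v) f
    ⇒fibre {v} f f≈ fᵢ≡v j j∉ with j ≟ᶠ i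
    ... | yes refl = trans fᵢ≡v (sym (lookup∘update i c v))
    ... | no j≢i   = trans (f≈ j λ { (here j≡i) → j≢i j≡i ; (there j∈) → j∉ j∈ })
                           (sym (lookup∘update′ j≢i c v))

    fibres-sum : sumTo (s i) fibre ≤ count (Agree? (i ∷ Is) c) E
    fibres-sum = count-fibres (Agree? (i ∷ Is) c) (λ v → Agree? Is (c [ i ]≔ v)) (λ f → lookup f i)
                              (s i) E (λ v f _ → fibre⇒ f)

    -- If the fibre over v₀ is empty, a box of the fibre over v₁ has the same edges as
    -- its widening by v₀ in coordinate i, which is a box of the whole subcube; so
    -- parity descends to the fibre over v₁.
    parity-descends : ∀ {v₀ v₁} → v₀ < s i → v₁ < s i → v₀ ≢ v₁ → fibre v₀ ≡ 0 →
      Parity (i ∷ Is) c → Parity Is (c [ i ]≔ v₁)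
    parity-descends {v₀} {v₁} v₀<sᵢ v₁<sᵢ v₀≢v₁ empty parity a b inside outside =
      subst (2 ∣_) same-edges (parity a (b [ i ]≔ v₀) inside′ outside′)
      where
      ≢i : ∀ {j} → j ∈ Is → j ≢ i
      ≢i j∈ refl = i∉Is j∈
      aᵢ≡v₁ : lookup a i ≡ v₁
      aᵢ≡v₁ = trans (proj₁ (outside i i∉Is)) (lookup∘update i c v₁)
      bᵢ≡v₁ : lookup b i ≡ v₁
      bᵢ≡v₁ = trans (proj₂ (outside i i∉Is)) (lookup∘update i c v₁)
      inside′ : ∀ j → j ∈ i ∷ Is → lookup a j < s j × lookup (b [ i ]≔ v₀) j < s j × lookup a j ≢ lookup (b [ i ]≔ v₀) j
      inside′ j (here refl) = subst (_< s i) (sym aᵢ≡v₁) v₁<sᵢ , subst (_< s i) (sym (lookup∘update i b v₀)) v₀<sᵢ ,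
                              λ e → v₀≢v₁ (trans (sym (lookup∘update i b v₀)) (trans (sym e) aᵢ≡v₁))
      inside′ j (there j∈) with inside j j∈
      ... | aⱼ< , bⱼ< , aⱼ≢bⱼ = aⱼ< , subst (_< s j) (sym (lookup∘update′ (≢i j∈) b v₀)) bⱼ< ,
                                λ e → aⱼ≢bⱼ (trans e (lookup∘update′ (≢i j∈) b v₀))
      outside′ : ∀ j → j ∉ i ∷ Is → lookup a j ≡ lookup c j × lookup (b [ i ]≔ v₀) j ≡ lookup c j
      outside′ j j∉ with outside j (j∉ ∘ there)
      ... | aⱼ≡ , bⱼ≡ = trans aⱼ≡ (lookup∘update′ j≢i c v₁) ,
                        trans (lookup∘update′ j≢i b v₀) (trans bⱼ≡ (lookup∘update′ j≢i c v₁))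
        where
        j≢i : j ≢ i
        j≢i refl = j∉ (here refl)
      both-centres : ∀ {j} → j ≢ i → lookup (c [ i ]≔ v₁) j ≡ lookup (c [ i ]≔ v₀) j
      both-centres j≢i = trans (lookup∘update′ j≢i c v₁) (sym (lookup∘update′ j≢i c v₀))
      -- the edges added by the widening: they would lie in the empty fibre over v₀
      added? : Decidable (λ f → InBox a (b [ i ]≔ v₀) f × lookup f i ≢ lookup a i)
      added? f = InBox? a (b [ i ]≔ v₀) f ×-dec ¬? (lookup f i ≟ lookup a i)
      added-in-fibre : ∀ f → f ∈ E → InBox a (b [ i ]≔ v₀) f × lookup f i ≢ lookup a i → Agree Is (c [ i ]≔ v₀) f
      added-in-fibre f _ (f∈ , fᵢ≢aᵢ) j j∉ with j ≟ᶠ i | f∈ j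
      ... | yes refl | inj₁ fᵢ≡aᵢ = ⊥-elim (fᵢ≢aᵢ fᵢ≡aᵢ)
      ... | yes refl | inj₂ fᵢ≡v₀ = trans fᵢ≡v₀ (trans (lookup∘update i b v₀) (sym (lookup∘update i c v₀)))
      ... | no j≢i | inj₁ fⱼ≡aⱼ = trans fⱼ≡aⱼ (trans (proj₁ (outside j j∉)) (both-centres j≢i))
      ... | no j≢i | inj₂ fⱼ≡bⱼ = trans fⱼ≡bⱼ (trans (lookup∘update′ j≢i b v₀) (trans (proj₂ (outside j j∉)) (both-centres j≢i)))
      same-edges : count (InBox? a (b [ i ]≔ v₀)) E ≡ count (InBox? a b) E
      same-edges = trans (box-widen a b i v₀ E (trans aᵢ≡v₁ (sym bᵢ≡v₁)))
        (trans (cong (count (InBox? a b) E +_)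
                  (n≤0⇒n≡0 (subst (count added? E ≤_) empty (count-mono added? (Agree? Is (c [ i ]≔ v₀)) E added-in-fibre))))
               (+-identityʳ _))

  -- Induction on Is: either every fibre along the first free coordinate i is inhabited,
  -- giving |V_i| ≥ m edges, or an empty fibre lets parity descend to the fibre of e.
  subcube-bound : ∀ m Is c {e} → Unique Is → (∀ j → j ∈ Is → m ≤ s j) → Parity Is c →
    e ∈ E → Agree Is c e → m ≤ count (Agree? Is c) E
  subcube-bound m [] c _ _ parity e∈E e≈c = ⊥-elim (point-parity c parity e∈E e≈c)
  subcube-bound m (i ∷ Is) c {e} (i≢Is ∷ Is-unique) sizes parity e∈E e≈c =
    by-fibres (anyUpTo? (λ v → fibre v ≟ 0) (s i))
    where
    i∉Is : i ∉ Is
    i∉Is i∈ = All.lookup i≢Is i∈ refl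
    open Fibres i∉Is c
    by-fibres : Dec (∃ λ v → v < s i × fibre v ≡ 0) → m ≤ count (Agree? (i ∷ Is) c) E
    by-fibres (no none) = begin
      m                ≤⟨ sizes i (here refl) ⟩
      s i              ≡⟨ sym (*-identityʳ (s i)) ⟩
      s i * 1          ≤⟨ sum-≥ (s i) fibre 1 (λ v v< → n≢0⇒n>0 (λ empty → none (v , v< , empty))) ⟩
      sumTo (s i) fibre ≤⟨ fibres-sum ⟩
      count (Agree? (i ∷ Is) c) E ∎
      where open ≤-Reasoning
    by-fibres (yes (v₀ , v₀<sᵢ , empty)) with v₀ ≟ lookup e i
    ... | yes refl = ⊥-elim (1+n≰n (subst (1 ≤_) empty (count-pos _ e∈E (⇒fibre e e≈c refl))))
    ... | no v₀≢eᵢ = ≤-trans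
      (subcube-bound m Is (c [ i ]≔ lookup e i) Is-unique (λ j j∈ → sizes j (there j∈))
        (parity-descends v₀<sᵢ (E-valid e e∈E i) v₀≢eᵢ empty parity) e∈E (⇒fibre e e≈c refl))
      (count-mono _ _ E (λ f _ → proj₁ ∘ fibre⇒ f))

toggle : ℕ → ℕ
toggle zero    = 1
toggle (suc _) = 0

toggle-≢ : ∀ x → toggle x ≢ x
toggle-≢ zero    ()
toggle-≢ (suc x) ()

toggle-< : ∀ x → toggle x < 2
toggle-< zero    = s≤s (s≤s z≤n)
toggle-< (suc _) = s≤s z≤n

avoid-two : ∀ x y → ∃ λ c → c < 3 × c ≢ x × c ≢ y
avoid-two 0             0             = 1 , s≤s (s≤s z≤n) , (λ ()) , (λ ())
avoid-two 0             1             = 2 , s≤s (s≤s (s≤s z≤n)) , (λ ()) , (λ ())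
avoid-two 0             (suc (suc y)) = 1 , s≤s (s≤s z≤n) , (λ ()) , (λ ())
avoid-two 1             0             = 2 , s≤s (s≤s (s≤s z≤n)) , (λ ()) , (λ ())
avoid-two 1             (suc y)       = 0 , s≤s z≤n , (λ ()) , (λ ())
avoid-two (suc (suc x)) 0             = 1 , s≤s (s≤s z≤n) , (λ ()) , (λ ())
avoid-two (suc (suc x)) (suc y)       = 0 , s≤s z≤n , (λ ()) , (λ ())

square-bound : ∀ m A P L → 2 ≤ A → m ≤ P → A + P * m ≤ L → m ^ 2 + 2 ≤ L
square-bound m A P L 2≤A m≤P A+Pm≤L = ≤-trans
  (subst (_≤ A + P * m) (+-comm 2 (m ^ 2))
    (+-mono-≤ 2≤A (≤-trans (≤-reflexive (cong (m *_) (*-identityʳ m))) (*-monoˡ-≤ m m≤P))))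
  A+Pm≤L

square-bound′ : ∀ {m} → 1 ≤ m → m ^ 2 + 2 ≤ 1 + m * suc m
square-bound′ {m} 1≤m = begin
  m ^ 2 + 2         ≡⟨ +-comm (m ^ 2) 2 ⟩
  2 + m * (m * 1)   ≡⟨ cong (λ x → 2 + m * x) (*-identityʳ m) ⟩
  2 + m * m         ≤⟨ s≤s (+-monoˡ-≤ (m * m) 1≤m) ⟩
  1 + (m + m * m)   ≡⟨ cong suc (sym (*-suc m m)) ⟩
  1 + m * suc m     ∎
  where open ≤-Reasoning

module Twins {n : ℕ} {s : Fin n → ℕ} (H : Hypergraph n s) (oct : IsOctahedral H) (noiso : NoIsolated H)
  {p q : Fin n} {xp xq : ℕ} (p≢q : p ≢ q) (xp<sp : xp < s p) (xq<sq : xq < s q)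
  (p⇒q : ∀ e → e ∈ edges H → lookup e p ≡ xp → lookup e q ≡ xq)
  (q⇒p : ∀ e → e ∈ edges H → lookup e q ≡ xq → lookup e p ≡ xp)
  (m : ℕ) (m<sp : m < s p) (m<sq : m < s q) (m≤others : ∀ r → r ≢ p → r ≢ q → m ≤ s r) where

  E : List (Vec ℕ n)
  E = edges H

  open Subcube s E (unique H) (edge-valid H)

  m≤sp-1 : m ≤ s p ∸ 1
  m≤sp-1 = ∸-monoˡ-≤ 1 m<sp

  m≤sq-1 : m ≤ s q ∸ 1
  m≤sq-1 = ∸-monoˡ-≤ 1 m<sq

  Others : List (Fin n)
  Others = filter (λ r → ¬? (r ≟ᶠ p) ×-dec ¬? (r ≟ᶠ q)) (allFin n)

  ∈-Others : ∀ {r} → r ≢ p → r ≢ q → r ∈ Others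
  ∈-Others r≢p r≢q = ∈-filter⁺ _ (∈-allFin _) (r≢p , r≢q)

  ∈-Others⁻ : ∀ {r} → r ∈ Others → r ≢ p × r ≢ q
  ∈-Others⁻ r∈ = proj₂ (∈-filter⁻ _ {xs = allFin n} r∈)

  p∉Others : p ∉ Others
  p∉Others p∈ = proj₁ (∈-Others⁻ p∈) refl

  q∉Others : q ∉ Others
  q∉Others q∈ = proj₂ (∈-Others⁻ q∈) refl

  data Position (r : Fin n) : Set where
    at-p  : r ≡ p → Position r
    at-q  : r ≡ q → Position r
    other : r ≢ p → r ≢ q → Position r

  position : ∀ r → Position r
  position r with r ≟ᶠ p | r ≟ᶠ q
  ... | yes r≡p | _       = at-p r≡p
  ... | no _    | yes r≡q = at-q r≡q
  ... | no r≢p  | no r≢q  = other r≢p r≢q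

  Through : ℕ → Vec ℕ n → Set
  Through u f = lookup f p ≡ u

  Through? : ∀ u → Decidable (Through u)
  Through? u f = lookup f p ≟ u

  InCell : ℕ → ℕ → Vec ℕ n → Set
  InCell u w f = lookup f p ≡ u × lookup f q ≡ w

  InCell? : ∀ u w → Decidable (InCell u w)
  InCell? u w f = (lookup f p ≟ u) ×-dec (lookup f q ≟ w)

  deg : ℕ → ℕ
  deg u = count (Through? u) E

  cell : ℕ → ℕ → ℕ
  cell u w = count (InCell? u w) E

  OffBox : Vec ℕ n → Vec ℕ n → Vec ℕ n → Set
  OffBox a b f = ∀ r → r ≢ p → r ≢ q → lookup f r ≡ lookup a r ⊎ lookup f r ≡ lookup b r

  OffBox? : ∀ a b → Decidable (OffBox a b)
  OffBox? a b f = all? (λ r → ¬? (r ≟ᶠ p) →-dec (¬? (r ≟ᶠ q) →-dec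
                              ((lookup f r ≟ lookup a r) ⊎-dec (lookup f r ≟ lookup b r))))

  Spans : Vec ℕ n → Vec ℕ n → Set
  Spans a b = ∀ r → r ≢ p → r ≢ q → lookup a r < s r × lookup b r < s r × lookup a r ≢ lookup b r

  TwinIn : Vec ℕ n → Vec ℕ n → Vec ℕ n → Set
  TwinIn a b f = Through xp f × OffBox a b f

  TwinIn? : ∀ a b → Decidable (TwinIn a b)
  TwinIn? a b f = Through? xp f ×-dec OffBox? a b f

  CellIn : ℕ → ℕ → Vec ℕ n → Vec ℕ n → Vec ℕ n → Set
  CellIn u w a b f = InCell u w f × OffBox a b f

  CellIn? : ∀ u w a b → Decidable (CellIn u w a b)
  CellIn? u w a b f = InCell? u w f ×-dec OffBox? a b f

  twins-in : Vec ℕ n → Vec ℕ n → ℕ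
  twins-in a b = count (TwinIn? a b) E

  cell-in : ℕ → ℕ → Vec ℕ n → Vec ℕ n → ℕ
  cell-in u w a b = count (CellIn? u w a b) E

  corner : Vec ℕ n → ℕ → ℕ → Vec ℕ n
  corner a x y = (a [ p ]≔ x) [ q ]≔ y

  corner-p : ∀ a x y → lookup (corner a x y) p ≡ x
  corner-p a x y = trans (lookup∘update′ p≢q (a [ p ]≔ x) y) (lookup∘update p a x)

  corner-q : ∀ a x y → lookup (corner a x y) q ≡ y
  corner-q a x y = lookup∘update q (a [ p ]≔ x) y

  corner-other : ∀ a x y {r} → r ≢ p → r ≢ q → lookup (corner a x y) r ≡ lookup a r
  corner-other a x y r≢p r≢q = trans (lookup∘update′ r≢q (a [ p ]≔ x) y) (lookup∘update′ r≢p a x)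

  corner-parity : ∀ a b {x y u w} → Spans a b → x < s p → y < s q → u < s p → w < s q →
    x ≢ u → y ≢ w → 2 ∣ count (InBox? (corner a x y) (corner b u w)) E
  corner-parity a b {x} {y} {u} {w} spans x< y< u< w< x≢u y≢w = box-parity H oct (corner a x y) (corner b u w) a-valid b-valid differ
    where
    a-valid : ∀ r → lookup (corner a x y) r < s r
    a-valid r with position r
    ... | at-p refl = subst (_< s p) (sym (corner-p a x y)) x<
    ... | at-q refl = subst (_< s q) (sym (corner-q a x y)) y<
    ... | other r≢p r≢q = subst (_< s r) (sym (corner-other a x y r≢p r≢q)) (proj₁ (spans r r≢p r≢q))
    b-valid : ∀ r → lookup (corner b u w) r < s r
    b-valid r with position r
    ... | at-p refl = subst (_< s p) (sym (corner-p b u w)) u<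
    ... | at-q refl = subst (_< s q) (sym (corner-q b u w)) w<
    ... | other r≢p r≢q = subst (_< s r) (sym (corner-other b u w r≢p r≢q)) (proj₁ (proj₂ (spans r r≢p r≢q)))
    differ : ∀ r → lookup (corner a x y) r ≢ lookup (corner b u w) r
    differ r with position r
    ... | at-p refl = λ e → x≢u (trans (sym (corner-p a x y)) (trans e (corner-p b u w)))
    ... | at-q refl = λ e → y≢w (trans (sym (corner-q a x y)) (trans e (corner-q b u w)))
    ... | other r≢p r≢q = λ e → proj₂ (proj₂ (spans r r≢p r≢q))
            (trans (sym (corner-other a x y r≢p r≢q)) (trans e (corner-other b u w r≢p r≢q)))

  -- The box with corners (a ; xp , xq) and (b ; u , w), u ≢ xp, consists of the twin
  -- edges of the off-box and the edges of the cell (u , w) in it: an edge of the box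
  -- meeting (q , xq) also meets (p , xp).
  corner-split : ∀ a b u w → u ≢ xp →
    count (InBox? (corner a xp xq) (corner b u w)) E ≡ twins-in a b + cell-in u w a b
  corner-split a b u w u≢xp =
    count-split (InBox? a′ b′) (TwinIn? a b) (CellIn? u w a b) E split from-twin from-cell disjoint
    where
    a′ b′ : Vec ℕ n
    a′ = corner a xp xq
    b′ = corner b u w
    off : ∀ f → InBox a′ b′ f → OffBox a b f
    off f f∈ r r≢p r≢q = Data.Sum.map (λ e → trans e (corner-other a xp xq r≢p r≢q))
                                      (λ e → trans e (corner-other b u w r≢p r≢q)) (f∈ r)
    split : ∀ f → f ∈ E → InBox a′ b′ f → TwinIn a b f ⊎ CellIn u w a b f
    split f f∈E f∈ with f∈ p | f∈ q
    ... | inj₁ fₚ≡ | _        = inj₁ (trans fₚ≡ (corner-p a xp xq) , off f f∈)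
    ... | inj₂ fₚ≡ | inj₂ f_q≡ = inj₂ ((trans fₚ≡ (corner-p b u w) , trans f_q≡ (corner-q b u w)) , off f f∈)
    ... | inj₂ fₚ≡ | inj₁ f_q≡ = ⊥-elim (u≢xp (trans (sym (trans fₚ≡ (corner-p b u w)))
                                                     (q⇒p f f∈E (trans f_q≡ (corner-q a xp xq)))))
    assemble : ∀ f → OffBox a b f → lookup f p ≡ lookup a′ p ⊎ lookup f p ≡ lookup b′ p →
      lookup f q ≡ lookup a′ q ⊎ lookup f q ≡ lookup b′ q → InBox a′ b′ f
    assemble f off-f atp atq r with position r
    ... | at-p refl = atp
    ... | at-q refl = atq
    ... | other r≢p r≢q = Data.Sum.map (λ e → trans e (sym (corner-other a xp xq r≢p r≢q)))
                                       (λ e → trans e (sym (corner-other b u w r≢p r≢q))) (off-f r r≢p r≢q)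
    from-twin : ∀ f → f ∈ E → TwinIn a b f → InBox a′ b′ f
    from-twin f f∈E (fₚ≡xp , off-f) = assemble f off-f (inj₁ (trans fₚ≡xp (sym (corner-p a xp xq))))
                                                        (inj₁ (trans (p⇒q f f∈E fₚ≡xp) (sym (corner-q a xp xq))))
    from-cell : ∀ f → f ∈ E → CellIn u w a b f → InBox a′ b′ f
    from-cell f _ ((fₚ≡u , f_q≡w) , off-f) = assemble f off-f (inj₂ (trans fₚ≡u (sym (corner-p b u w))))
                                                               (inj₂ (trans f_q≡w (sym (corner-q b u w))))
    disjoint : ∀ f → f ∈ E → TwinIn a b f → ¬ CellIn u w a b f
    disjoint f _ (fₚ≡xp , _) ((fₚ≡u , _) , _) = u≢xp (trans (sym fₚ≡u) fₚ≡xp)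

  twin-parity : ∀ a b u w → u < s p → w < s q → u ≢ xp → w ≢ xq → Spans a b →
    2 ∣ twins-in a b + cell-in u w a b
  twin-parity a b u w u< w< u≢xp w≢xq spans = subst (2 ∣_) (corner-split a b u w u≢xp)
    (corner-parity a b spans xp<sp xq<sq u< w< (u≢xp ∘ sym) (w≢xq ∘ sym))

  cells-sum : ∀ u → sumTo (s q) (cell u) ≤ deg u
  cells-sum u = count-fibres (Through? u) (InCell? u) (λ f → lookup f q) (s q) E (λ w f _ f∈cell → f∈cell)

  degrees-sum : sumTo (s p) deg ≤ length E
  degrees-sum = ≤-trans (count-fibres (λ _ → yes tt) Through? (λ f → lookup f p) (s p) E (λ u f _ fₚ≡u → tt , fₚ≡u))
                        (≤-reflexive (count-all E))

  deg-from-cells : ∀ u → (∀ w → w < s q → w ≢ xq → 1 ≤ cell u w) → s q ∸ 1 ≤ deg u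
  deg-from-cells u nonempty = begin
    s q ∸ 1                   ≡⟨ sym (*-identityʳ _) ⟩
    (s q ∸ 1) * 1             ≤⟨ m≤n+m _ (cell u xq) ⟩
    cell u xq + (s q ∸ 1) * 1 ≤⟨ sum-≥-but (s q) (cell u) 1 xq xq<sq nonempty ⟩
    sumTo (s q) (cell u)      ≤⟨ cells-sum u ⟩
    deg u                     ∎
    where open ≤-Reasoning

  -- If the cell (u , w₀) is empty, the twin-parity for w₀ makes the twin edges of each
  -- off-box even, hence so are the edges of the cell (u , g_q) in it; these are exactly
  -- the edges of the corresponding box in the Others-subcube through the edge g.
  empty-cell-parity : ∀ {u w₀ g} → u < s p → u ≢ xp → w₀ < s q → w₀ ≢ xq → cell u w₀ ≡ 0 →
    g ∈ E → lookup g p ≡ u → Parity Others g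
  empty-cell-parity {u} {w₀} {g} u< u≢xp w₀< w₀≢xq empty g∈E gₚ≡u a b inside outside =
    subst (2 ∣_) (sym box≡cell) cell-even
    where
    spans : Spans a b
    spans r r≢p r≢q = inside r (∈-Others r≢p r≢q)
    w₁ : ℕ
    w₁ = lookup g q
    w₁≢xq : w₁ ≢ xq
    w₁≢xq g_q≡xq = u≢xp (trans (sym gₚ≡u) (q⇒p g g∈E g_q≡xq))
    no-w₀ : cell-in u w₀ a b ≡ 0
    no-w₀ = n≤0⇒n≡0 (subst (cell-in u w₀ a b ≤_) empty
                       (count-mono (CellIn? u w₀ a b) (InCell? u w₀) E (λ _ _ → proj₁)))
    twins-even : 2 ∣ twins-in a b
    twins-even = subst (2 ∣_) (trans (cong (twins-in a b +_) no-w₀) (+-identityʳ _))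
                       (twin-parity a b u w₀ u< w₀< u≢xp w₀≢xq spans)
    cell-even : 2 ∣ cell-in u w₁ a b
    cell-even = ∣m+n∣m⇒∣n (twin-parity a b u w₁ u< (edge-valid H g g∈E q) u≢xp w₁≢xq spans) twins-even
    fixed : ∀ {r} → r ∉ Others → ∀ f → InBox a b f → lookup f r ≡ lookup g r
    fixed {r} r∉ f f∈ = [ (λ e → trans e (proj₁ (outside r r∉))) , (λ e → trans e (proj₂ (outside r r∉))) ] (f∈ r)
    to-cell : ∀ f → f ∈ E → InBox a b f → CellIn u w₁ a b f
    to-cell f _ f∈ = (trans (fixed p∉Others f f∈) gₚ≡u , fixed q∉Others f f∈) , (λ r _ _ → f∈ r)
    from-cell : ∀ f → f ∈ E → CellIn u w₁ a b f → InBox a b f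
    from-cell f _ ((fₚ≡u , f_q≡w₁) , off-f) r with position r
    ... | at-p refl = inj₁ (trans fₚ≡u (sym (trans (proj₁ (outside p p∉Others)) gₚ≡u)))
    ... | at-q refl = inj₁ (trans f_q≡w₁ (sym (proj₁ (outside q q∉Others))))
    ... | other r≢p r≢q = off-f r r≢p r≢q
    box≡cell : count (InBox? a b) E ≡ cell-in u w₁ a b
    box≡cell = count-ext (InBox? a b) (CellIn? u w₁ a b) E to-cell from-cell

  -- Every vertex (p , u) other than the twin lies in at least m edges: either it meets
  -- all cells (u , w), w ≢ xq, or one is empty and the subcube lemma applies.
  deg-other : ∀ u → u < s p → u ≢ xp → m ≤ deg u
  deg-other u u< u≢xp = by-cells (anyUpTo? (λ w → ¬? (w ≟ xq) ×-dec (cell u w ≟ 0)) (s q))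
    where
    by-cells : Dec (∃ λ w → w < s q × (w ≢ xq × cell u w ≡ 0)) → m ≤ deg u
    by-cells (no none) = ≤-trans m≤sq-1 (deg-from-cells u λ w w< w≢xq →
                           n≢0⇒n>0 (λ empty → none (w , w< , w≢xq , empty)))
    by-cells (yes (w₀ , w₀< , w₀≢xq , empty)) with noiso (p , u) u<
    ... | g , g∈E , gₚ≡u = ≤-trans
      (subcube-bound m Others g Others-unique (λ j j∈ → m≤others j (proj₁ (∈-Others⁻ j∈)) (proj₂ (∈-Others⁻ j∈)))
        (empty-cell-parity u< u≢xp w₀< w₀≢xq empty g∈E gₚ≡u) g∈E (λ _ _ → refl))
      (count-mono (Agree? Others g) (Through? u) E (λ f _ f≈g → trans (f≈g p p∉Others) gₚ≡u))
      where
      Others-unique : Unique Others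
      Others-unique = filter⁺ _ (allFin⁺ n)

  twin-deg-pos : 1 ≤ deg xp
  twin-deg-pos with noiso (p , xp) xp<sp
  ... | e , e∈E , eₚ≡xp = count-pos (Through? xp) e∈E eₚ≡xp

  edge-bound : deg xp + (s p ∸ 1) * m ≤ length E
  edge-bound = ≤-trans (sum-≥-but (s p) deg m xp xp<sp deg-other) degrees-sum

  -- When (p , xp) lies in a single edge e₀, every off-box with corner e₀ contains exactly
  -- one twin edge, so by twin-parity it meets every cell (u , w) with u ≢ xp, w ≢ xq.
  module SimpleTwin (simple : deg xp ≡ 1) where

    e₀ : Vec ℕ n
    e₀ = proj₁ (noiso (p , xp) xp<sp)

    e₀∈E : e₀ ∈ E
    e₀∈E = proj₁ (proj₂ (noiso (p , xp) xp<sp))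

    e₀ₚ≡xp : lookup e₀ p ≡ xp
    e₀ₚ≡xp = proj₂ (proj₂ (noiso (p , xp) xp<sp))

    only-e₀ : ∀ f → f ∈ E → lookup f p ≡ xp → f ≡ e₀
    only-e₀ f f∈E fₚ≡xp with ≡-dec _≟_ f e₀
    ... | yes f≡e₀ = f≡e₀
    ... | no f≢e₀  = ⊥-elim (1+n≰n (subst (2 ≤_) simple (count-two (Through? xp) f∈E e₀∈E f≢e₀ fₚ≡xp e₀ₚ≡xp)))

    twins-in-e₀ : ∀ b → twins-in e₀ b ≡ 1
    twins-in-e₀ b = ≤-antisym
      (≤-trans (count-mono (TwinIn? e₀ b) (Through? xp) E (λ _ _ → proj₁)) (≤-reflexive simple))
      (count-pos (TwinIn? e₀ b) e₀∈E (e₀ₚ≡xp , λ _ _ _ → inj₁ refl))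

    cell-in-e₀ : ∀ b u w → Spans e₀ b → u < s p → w < s q → u ≢ xp → w ≢ xq → 1 ≤ cell-in u w e₀ b
    cell-in-e₀ b u w spans u< w< u≢xp w≢xq = n≢0⇒n>0 λ empty →
      2∤1 (subst (2 ∣_) (cong₂ _+_ (twins-in-e₀ b) empty) (twin-parity e₀ b u w u< w< u≢xp w≢xq spans))

    e₀′ : Vec ℕ n
    e₀′ = Vec.map toggle e₀

    spans₀ : Spans e₀ e₀′
    spans₀ r _ _ = edge-valid H e₀ e₀∈E r ,
                   subst (_< s r) (sym (lookup-map r toggle e₀)) (≤-trans (toggle-< _) (proj₁ oct r)) ,
                   λ e → toggle-≢ _ (sym (trans e (lookup-map r toggle e₀)))

    cell-nonempty : ∀ u w → u < s p → w < s q → u ≢ xp → w ≢ xq → 1 ≤ cell u w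
    cell-nonempty u w u< w< u≢xp w≢xq = ≤-trans (cell-in-e₀ e₀′ u w spans₀ u< w< u≢xp w≢xq)
                                                (count-mono (CellIn? u w e₀ e₀′) (InCell? u w) E (λ _ _ → proj₁))

    edge-bound-simple : 1 + (s p ∸ 1) * (s q ∸ 1) ≤ length E
    edge-bound-simple = subst (λ d → d + (s p ∸ 1) * (s q ∸ 1) ≤ length E) simple
      (≤-trans (sum-≥-but (s p) deg (s q ∸ 1) xp xp<sp
                 (λ u u< u≢xp → deg-from-cells u (λ w w< → cell-nonempty u w u< w< u≢xp)))
               degrees-sum)

    -- Take an edge g through (r , toggle e₀ᵣ); then g ≠ e₀, so u = g_p ≢ xp.  Moving the
    -- opposite corner in coordinate r to a third value c yields an off-box with corner e₀
    -- that meets the cell of g, yet misses g; so that cell has two edges and deg u > m.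
    module ThirdPart {r : Fin n} (r≢p : r ≢ p) (r≢q : r ≢ q) (3≤sr : 3 ≤ s r) where

      through-toggle : ∃ λ g → g ∈ E × lookup g r ≡ toggle (lookup e₀ r)
      through-toggle = noiso (r , _) (≤-trans (toggle-< _) (≤-trans (s≤s (s≤s z≤n)) 3≤sr))

      g : Vec ℕ n
      g = proj₁ through-toggle

      g∈E : g ∈ E
      g∈E = proj₁ (proj₂ through-toggle)

      u w : ℕ
      u = lookup g p
      w = lookup g q

      u≢xp : u ≢ xp
      u≢xp gₚ≡xp = toggle-≢ (lookup e₀ r)
        (trans (sym (proj₂ (proj₂ through-toggle))) (cong (λ f → lookup f r) (only-e₀ g g∈E gₚ≡xp)))

      w≢xq : w ≢ xq
      w≢xq g_q≡xq = u≢xp (q⇒p g g∈E g_q≡xq)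

      third : ∃ λ c → c < 3 × c ≢ lookup e₀ r × c ≢ toggle (lookup e₀ r)
      third = avoid-two (lookup e₀ r) (toggle (lookup e₀ r))

      c : ℕ
      c = proj₁ third

      b₁ : Vec ℕ n
      b₁ = e₀′ [ r ]≔ c

      spans₁ : Spans e₀ b₁
      spans₁ r′ r′≢p r′≢q with r′ ≟ᶠ r
      ... | yes refl = edge-valid H e₀ e₀∈E r ,
                       subst (_< s r) (sym (lookup∘update r e₀′ c)) (≤-trans (proj₁ (proj₂ third)) 3≤sr) ,
                       λ e → proj₁ (proj₂ (proj₂ third)) (sym (trans e (lookup∘update r e₀′ c)))
      ... | no r′≢r with spans₀ r′ r′≢p r′≢q
      ...   | a< , b< , a≢b = a< , subst (_< s r′) (sym (lookup∘update′ r′≢r e₀′ c)) b< ,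
                              λ e → a≢b (trans e (lookup∘update′ r′≢r e₀′ c))

      g-outside : ¬ OffBox e₀ b₁ g
      g-outside off-g with off-g r r≢p r≢q
      ... | inj₁ gᵣ≡e₀ᵣ = toggle-≢ _ (trans (sym (proj₂ (proj₂ through-toggle))) gᵣ≡e₀ᵣ)
      ... | inj₂ gᵣ≡c   = proj₂ (proj₂ (proj₂ third))
                            (sym (trans (sym (proj₂ (proj₂ through-toggle))) (trans gᵣ≡c (lookup∘update r e₀′ c))))

      OutsideCell? : Decidable (λ f → InCell u w f × ¬ OffBox e₀ b₁ f)
      OutsideCell? f = InCell? u w f ×-dec ¬? (OffBox? e₀ b₁ f)

      u< : u < s p
      u< = edge-valid H g g∈E p

      w< : w < s q
      w< = edge-valid H g g∈E q

      cell-≥2 : 2 ≤ cell u w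
      cell-≥2 = begin
        1 + 1 ≤⟨ +-mono-≤ (cell-in-e₀ b₁ u w spans₁ u< w< u≢xp w≢xq) (count-pos OutsideCell? g∈E ((refl , refl) , g-outside)) ⟩
        cell-in u w e₀ b₁ + count OutsideCell? E
          ≡⟨ sym (count-split (InCell? u w) (CellIn? u w e₀ b₁) OutsideCell? E split
                              (λ _ _ → proj₁) (λ _ _ → proj₁) (λ _ _ inside outside → proj₂ outside (proj₂ inside))) ⟩
        cell u w ∎
        where
        open ≤-Reasoning
        split : ∀ f → f ∈ E → InCell u w f → CellIn u w e₀ b₁ f ⊎ (InCell u w f × ¬ OffBox e₀ b₁ f)
        split f _ f∈cell with OffBox? e₀ b₁ f
        ... | yes off-f = inj₁ (f∈cell , off-f)
        ... | no ¬off-f = inj₂ (f∈cell , ¬off-f)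

      -- the cell of g has two edges, the other cells of (p , u) at least one
      deg-u : m < deg u
      deg-u = begin-strict
        m                         ≤⟨ m≤sq-1 ⟩
        s q ∸ 1                   ≡⟨ sym (*-identityʳ _) ⟩
        (s q ∸ 1) * 1             ≤⟨ m≤n+m _ (cell u xq) ⟩
        cell u xq + (s q ∸ 1) * 1 <⟨ sum->-but (s q) (cell u) 1 xq w xq<sq w< (w≢xq ∘ sym)
                                       (λ w′ w′< → cell-nonempty u w′ u< w′< u≢xp) cell-≥2 ⟩
        sumTo (s q) (cell u)      ≤⟨ cells-sum u ⟩
        deg u                     ∎
        where open ≤-Reasoning

      edge-bound-third : 2 + (s p ∸ 1) * m ≤ length E
      edge-bound-third = subst (λ d → suc (d + (s p ∸ 1) * m) ≤ length E) simple
        (≤-trans (sum->-but (s p) deg m xp u xp<sp u< (u≢xp ∘ sym) deg-other deg-u) degrees-sum)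

  twin-bound : 1 ≤ m →
    m ^ 2 + 2 ≤ length E ⊎ ((∀ r → r ≢ p → r ≢ q → s r ≤ 2) × s p ≡ suc m × s q ≡ suc m)
  twin-bound 1≤m = by-degree (2 ≤? deg xp)
    where
    by-degree : Dec (2 ≤ deg xp) →
      m ^ 2 + 2 ≤ length E ⊎ ((∀ r → r ≢ p → r ≢ q → s r ≤ 2) × s p ≡ suc m × s q ≡ suc m)
    by-degree (yes 2≤deg) = inj₁ (square-bound m _ _ _ 2≤deg m≤sp-1 edge-bound)
    by-degree (no 2≰deg) = by-shape (any? λ r → ¬? (r ≟ᶠ p) ×-dec (¬? (r ≟ᶠ q) ×-dec (3 ≤? s r)))
                                    (suc m <? s q) (suc m <? s p)
      where
      simple : deg xp ≡ 1
      simple = ≤-antisym (≤-pred (≰⇒> 2≰deg)) twin-deg-pos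
      open SimpleTwin simple
      exactly : ∀ {x} → m < x → ¬ suc m < x → x ≡ suc m
      exactly m<x ¬sm<x = ≤-antisym (≤-pred (≰⇒> ¬sm<x)) m<x
      by-shape : Dec (∃ λ r → r ≢ p × r ≢ q × 3 ≤ s r) → Dec (suc m < s q) → Dec (suc m < s p) →
        m ^ 2 + 2 ≤ length E ⊎ ((∀ r → r ≢ p → r ≢ q → s r ≤ 2) × s p ≡ suc m × s q ≡ suc m)
      by-shape (yes (r , r≢p , r≢q , 3≤sr)) _ _ =
        inj₁ (square-bound m 2 _ _ ≤-refl m≤sp-1 (ThirdPart.edge-bound-third r≢p r≢q 3≤sr))
      by-shape (no _) (yes sm<sq) _ = inj₁ (≤-trans (square-bound′ 1≤m)
        (≤-trans (+-monoʳ-≤ 1 (*-mono-≤ m≤sp-1 (∸-monoˡ-≤ 1 sm<sq))) edge-bound-simple))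
      by-shape (no _) (no _) (yes sm<sp) = inj₁ (≤-trans (square-bound′ 1≤m)
        (≤-trans (+-monoʳ-≤ 1 (≤-trans (≤-reflexive (*-comm m (suc m))) (*-monoˡ-≤ m (∸-monoˡ-≤ 1 sm<sp))))
                 (subst (λ d → d + (s p ∸ 1) * m ≤ length E) simple edge-bound)))
      by-shape (no none) (no ¬sm<sq) (no ¬sm<sp) =
        inj₂ ((λ r r≢p r≢q → ≤-pred (≰⇒> λ 3≤sr → none (r , r≢p , r≢q , 3≤sr))) ,
              exactly m<sp ¬sm<sp , exactly m<sq ¬sm<sq)

  -- in the tight configuration, still |E| ≥ 1 + 2·2
  five-edges : 2 ≤ m → 5 ≤ length E
  five-edges 2≤m = ≤-trans (+-mono-≤ twin-deg-pos (*-mono-≤ (≤-trans 2≤m m≤sp-1) 2≤m)) edge-bound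

in-pair : ∀ {n} {p q : Fin n} r → (r ≢ p → r ≢ q → ⊥) → r ≡ p ⊎ r ≡ q
in-pair {p = p} {q} r cannot-avoid with r ≟ᶠ p | r ≟ᶠ q
... | yes r≡p | _       = inj₁ r≡p
... | no _    | yes r≡q = inj₂ r≡q
... | no r≢p  | no r≢q  = ⊥-elim (cannot-avoid r≢p r≢q)

pigeonhole : ∀ {n} {p q a b c : Fin n} → a ≢ b → a ≢ c → b ≢ c →
  a ≡ p ⊎ a ≡ q → b ≡ p ⊎ b ≡ q → c ≡ p ⊎ c ≡ q → ⊥
pigeonhole a≢b _   _   (inj₁ a≡p) (inj₁ b≡p) _          = a≢b (trans a≡p (sym b≡p))
pigeonhole a≢b _   _   (inj₂ a≡q) (inj₂ b≡q) _          = a≢b (trans a≡q (sym b≡q))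
pigeonhole _   a≢c _   (inj₁ a≡p) (inj₂ _)   (inj₁ c≡p) = a≢c (trans a≡p (sym c≡p))
pigeonhole _   _   b≢c (inj₁ _)   (inj₂ b≡q) (inj₂ c≡q) = b≢c (trans b≡q (sym c≡q))
pigeonhole _   _   b≢c (inj₂ _)   (inj₁ b≡p) (inj₁ c≡p) = b≢c (trans b≡p (sym c≡p))
pigeonhole _   a≢c _   (inj₂ a≡q) (inj₁ _)   (inj₂ c≡q) = a≢c (trans a≡q (sym c≡q))

third-part : ∀ {n} → 3 ≤ n → (p q : Fin n) → ∃ λ r → r ≢ p × r ≢ q
third-part {suc (suc (suc n))} (s≤s (s≤s (s≤s _))) p q with any? (λ r → ¬? (r ≟ᶠ p) ×-dec ¬? (r ≟ᶠ q))
... | yes found = found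
... | no none   = ⊥-elim (pigeonhole {a = 0F} {1F} {2F} (λ ()) (λ ()) (λ ()) (pair 0F) (pair 1F) (pair 2F))
  where
  pair : ∀ r → r ≡ p ⊎ r ≡ q
  pair r = in-pair r (λ r≢p r≢q → none (r , r≢p , r≢q))

shape-2233 : ∀ {n} (s : Fin n → ℕ) {p q : Fin n} → 4 ≤ n →
  (∀ r → r ≢ p → r ≢ q → s r ≡ 2 × toℕ r ≤ 1) → s p ≡ 3 → s q ≡ 3 → tabulate s ≡ 2 ∷ 2 ∷ 3 ∷ 3 ∷ []
shape-2233 {suc (suc (suc (suc zero)))} s {p} {q} (s≤s (s≤s (s≤s (s≤s _)))) others sp sq =
  cong₂ _∷_ (small 0F (λ ()) (λ ())) (cong₂ _∷_ (small 1F (λ ()) (λ ()))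
    (cong₂ _∷_ (large 2F (s≤s (s≤s z≤n))) (cong₂ _∷_ (large 3F (s≤s (s≤s z≤n))) refl)))
  where
  pair : ∀ r → 1 < toℕ r → r ≡ p ⊎ r ≡ q
  pair r 1<r = in-pair r (λ r≢p r≢q → <⇒≱ 1<r (proj₂ (others r r≢p r≢q)))
  large : ∀ r → 1 < toℕ r → s r ≡ 3
  large r 1<r = [ (λ r≡p → trans (cong s r≡p) sp) , (λ r≡q → trans (cong s r≡q) sq) ] (pair r 1<r)
  small : ∀ r → r ≢ 2F → r ≢ 3F → s r ≡ 2
  small r r≢2 r≢3 with r ≟ᶠ p | r ≟ᶠ q
  ... | no r≢p  | no r≢q  = proj₁ (others r r≢p r≢q)
  ... | yes r≡p | _       = ⊥-elim (pigeonhole r≢2 r≢3 (λ ()) (inj₁ r≡p) (pair 2F (s≤s (s≤s z≤n))) (pair 3F (s≤s (s≤s z≤n))))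
  ... | no _    | yes r≡q = ⊥-elim (pigeonhole r≢2 r≢3 (λ ()) (inj₂ r≡q) (pair 2F (s≤s (s≤s z≤n))) (pair 3F (s≤s (s≤s z≤n))))
shape-2233 {suc (suc (suc (suc (suc n))))} s {p} {q} (s≤s (s≤s (s≤s (s≤s _)))) others _ _ =
  ⊥-elim (pigeonhole {a = 2F} {3F} {4F} (λ ()) (λ ()) (λ ()) (pair 2F (s≤s (s≤s z≤n))) (pair 3F (s≤s (s≤s z≤n))) (pair 4F (s≤s (s≤s z≤n))))
  where
  pair : ∀ r → 1 < toℕ r → r ≡ p ⊎ r ≡ q
  pair r 1<r = in-pair r (λ r≢p r≢q → <⇒≱ 1<r (proj₂ (others r r≢p r≢q)))

-- The size profile of the theorem: |V_i| = k - 1 for i < z, |V_i| = k for z ≤ i < k and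
-- |V_i| ≥ k for i ≥ k.  Parts from index z on have at least k vertices ...
upper-size : ∀ {n k z} (s : Fin n → ℕ) → (∀ i → z ≤ toℕ i → toℕ i < k → s i ≡ k) →
  (∀ i → k ≤ toℕ i → k ≤ s i) → ∀ i → z ≤ toℕ i → k ≤ s i
upper-size {k = k} s mid high i z≤i with toℕ i <? k
... | yes i<k = ≤-reflexive (sym (mid i z≤i i<k))
... | no i≮k  = high i (≮⇒≥ i≮k)

lower-size : ∀ {n k z} (s : Fin n → ℕ) → (∀ i → toℕ i < z → s i ≡ k ∸ 1) →
  (∀ i → z ≤ toℕ i → k ≤ s i) → ∀ i → k ∸ 1 ≤ s i
lower-size {k = k} {z} s low upper i with toℕ i <? z
... | yes i<z = ≤-reflexive (sym (low i i<z))
... | no i≮z  = ≤-trans (m∸n≤m k 1) (upper i (≮⇒≥ i≮z))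

exceptional-shape : ∀ {n k z} (s : Fin n → ℕ) {p q : Fin n} → 4 ≤ n → 3 ≤ k → z < k →
  (∀ i → toℕ i < z → s i ≡ k ∸ 1) → (∀ i → z ≤ toℕ i → k ≤ s i) → (∀ i → 2 ≤ s i) →
  (∀ r → r ≢ p → r ≢ q → s r ≤ 2) → s p ≡ k → s q ≡ k → tabulate s ≡ 2 ∷ 2 ∷ 3 ∷ 3 ∷ []
exceptional-shape {k = k} {z} s {p} {q} 4≤n 3≤k z<k low upper two small sp sq =
  shape-2233 s 4≤n others (trans sp k≡3) (trans sq k≡3)
  where
  r₀ : ∃ λ r → r ≢ p × r ≢ q
  r₀ = third-part (≤-trans (n≤1+n 3) 4≤n) p q
  k≤3 : k ≤ 3
  k≤3 = ≤-trans (m≤n+m∸n k 1)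
          (s≤s (≤-trans (lower-size s low upper (proj₁ r₀)) (small (proj₁ r₀) (proj₁ (proj₂ r₀)) (proj₂ (proj₂ r₀)))))
  k≡3 : k ≡ 3
  k≡3 = ≤-antisym k≤3 3≤k
  others : ∀ r → r ≢ p → r ≢ q → s r ≡ 2 × toℕ r ≤ 1
  others r r≢p r≢q with toℕ r <? z
  ... | yes r<z = ≤-antisym (small r r≢p r≢q) (two r) , ≤-pred (≤-trans r<z (≤-pred (≤-trans z<k k≤3)))
  ... | no r≮z  = ⊥-elim (1+n≰n (≤-trans (≤-trans 3≤k (upper r (≮⇒≥ r≮z))) (small r r≢p r≢q)))

-- Lemma 4.2.  The first two vertices of X lie in distinct parts and are twins, since X
-- induces a complete subgraph of D(Ω); the parts p and q have at least k = m + 1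
-- vertices and all parts at least m, so the twin bound applies.
lemma4p2 : (n k z : ℕ) (s : Fin n → ℕ) (H : Hypergraph n s) →
    4 ≤ n → 3 ≤ k → z < k → k ≤ n →
    (∀ i → toℕ i < z → s i ≡ k ∸ 1) →
    (∀ i → z ≤ toℕ i → toℕ i < k → s i ≡ k) →
    (∀ i → k ≤ toℕ i → k ≤ s i) →
    (∀ i j → k ≤ toℕ i → toℕ i ≤ toℕ j → s i ≤ s j) →
    IsOctahedral H → NoIsolated H →
    (X : List (Vertex n)) → Unique X → All (ValidVertex s) X →
    All (λ v → z ≤ toℕ (proj₁ v)) X → 2 ≤ length X →
    InducesComplete H X → NoOutneighbour H X →
    (¬ (tabulate s ≡ 2 ∷ 2 ∷ 3 ∷ 3 ∷ []) → (k ∸ 1) ^ 2 + 2 ≤ length (edges H)) ×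
    (tabulate s ≡ 2 ∷ 2 ∷ 3 ∷ 3 ∷ [] → 5 ≤ length (edges H))
lemma4p2 _ _ _ _ _ _ _ _ _ _ _ _ _ _ _ [] _ _ _ () _ _
lemma4p2 _ _ _ _ _ _ _ _ _ _ _ _ _ _ _ (_ ∷ []) _ _ _ (s≤s ()) _ _
lemma4p2 n (suc (suc (suc k′))) z s H 4≤n 3≤k@(s≤s (s≤s (s≤s _))) z<k _ low mid high _ oct noiso
  ((p , xp) ∷ (q , xq) ∷ _) ((x≢y ∷ _) ∷ _) (xp<sp ∷ xq<sq ∷ _) (z≤p ∷ z≤q ∷ _) _ complete _ =
  general , tight
  where
  m : ℕ
  m = suc (suc k′)
  upper : ∀ i → z ≤ toℕ i → suc m ≤ s i
  upper = upper-size s mid high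
  x→y : Arc H (p , xp) (q , xq)
  x→y = complete (p , xp) (q , xq) (here refl) (there (here refl)) x≢y
  y→x : Arc H (q , xq) (p , xp)
  y→x = complete (q , xq) (p , xp) (there (here refl)) (here refl) (x≢y ∘ sym)
  open Twins H oct noiso (arc-parts-differ H noiso xp<sp y→x) xp<sp xq<sq (proj₂ y→x) (proj₂ x→y)
             m (upper p z≤p) (upper q z≤q) (λ r _ _ → lower-size s low upper r)
  general : ¬ (tabulate s ≡ 2 ∷ 2 ∷ 3 ∷ 3 ∷ []) → m ^ 2 + 2 ≤ length (edges H)
  general not-2233 = [ id , (λ { (small , sp , sq) →
    ⊥-elim (not-2233 (exceptional-shape s 4≤n 3≤k z<k low upper (proj₁ oct) small sp sq)) }) ]′ (twin-bound (s≤s z≤n))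
  tight : tabulate s ≡ 2 ∷ 2 ∷ 3 ∷ 3 ∷ [] → 5 ≤ length (edges H)
  tight _ = five-edges (s≤s (s≤s z≤n))
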